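{- For every $n\ge 2$, \[\max_{\pi\in\mathcal{S}_n}\ \min_{1\le i\le n-1}|\pi_{i+1}-\pi_i| = \lfloor n/2\rfloor,\] where $\mathcal{S}_n$ is the set of permutations $\pi=(\pi_1,\ldots,\pi_n)$ of $\{1,\ldots,n\}$. -}

module Defs where

open import Data.Nat using (ℕ; zero; suc; _⊓_; ∣_-_∣)
open import Data.Fin using (Fin; toℕ; inject₁) renaming (suc to fsuc; zero to fzero)
open import Data.Fin.Permutation using (Permutation′; _⟨$⟩ʳ_)

minFin : (k : ℕ) → (Fin (suc k) → ℕ) → ℕ
minFin zero    f = f fzero
minFin (suc k) f = f fzero ⊓ minFin k (λ i → f (fsuc i))

-- The permutation π of {0,…,n-1} (n = m+2) is read as the sequence
-- (π(0), …, π(n-1)); positions i and i+1 for i = 0 … n-2 are adjacent.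
-- Values 0…n-1 instead of 1…n: shifting by one does not change differences.
gap : (m : ℕ) → Permutation′ (suc (suc m)) → Fin (suc m) → ℕ
gap m π i = ∣ toℕ (π ⟨$⟩ʳ fsuc i) - toℕ (π ⟨$⟩ʳ inject₁ i) ∣

minGap : (m : ℕ) → Permutation′ (suc (suc m)) → ℕ
minGap m π = minFin m (gap m π)

{-# OPTIONS --safe #-}
-- Upper bound: the value c = ⌊(n-1)/2⌋ has a neighbour in the sequence, and every value in
-- {0,…,n-1} lies within ⌊n/2⌋ of c. Lower bound: with h = ⌊n/2⌋, the interleaving
-- h, 0, h+1, 1, h+2, 2, … is a permutation of {0,…,n-1} whose consecutive gaps alternate
-- between h and h+1.
module Submission where

open import Defs
open import Data.Nat using (ℕ; zero; suc; _+_; _∸_; _≤_; _<_; _/_; ⌊_/2⌋; ⌈_/2⌉; ∣_-_∣; z≤n; s≤s; s≤s⁻¹; z<s; s<s; s<s⁻¹; _<?_)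
open import Data.Nat.Properties
open import Data.Nat.DivMod using (m/n≡1+[m∸n]/n)
open import Data.Fin using (Fin; toℕ; fromℕ<; inject₁) renaming (zero to fzero; suc to fsuc)
open import Data.Fin.Properties using (toℕ-fromℕ<; toℕ-inject₁; toℕ<n; toℕ-injective)
open import Data.Fin.Permutation using (Permutation′; permutation; _⟨$⟩ʳ_; _⟨$⟩ˡ_; inverseʳ)
open import Data.Product using (_×_; _,_; ∃)
open import Relation.Nullary using (yes; no)
open import Relation.Nullary.Negation using (contradiction)
open import Relation.Binary.PropositionalEquality using (_≡_; refl; sym; trans; cong; cong₂; subst; module ≡-Reasoning)

n/2≡⌊n/2⌋ : ∀ n → n / 2 ≡ ⌊ n /2⌋
n/2≡⌊n/2⌋ zero          = refl
n/2≡⌊n/2⌋ (suc zero)    = refl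
n/2≡⌊n/2⌋ (suc (suc n)) = trans (m/n≡1+[m∸n]/n {suc (suc n)} {2} (s≤s (s≤s z≤n))) (cong suc (n/2≡⌊n/2⌋ n))

m+m<n⇒m<⌈n/2⌉ : ∀ {m n} → m + m < n → m < ⌈ n /2⌉
m+m<n⇒m<⌈n/2⌉ {zero}  {suc n}       _          = z<s
m+m<n⇒m<⌈n/2⌉ {suc m} {suc zero}    (s<s ())
m+m<n⇒m<⌈n/2⌉ {suc m} {suc (suc n)} m+m<n rewrite +-suc m m =
  s<s (m+m<n⇒m<⌈n/2⌉ (s<s⁻¹ (s<s⁻¹ m+m<n)))

m<⌈n/2⌉⇒m+m<n : ∀ {m n} → m < ⌈ n /2⌉ → m + m < n
m<⌈n/2⌉⇒m+m<n {zero}  {suc n}       _          = z<s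
m<⌈n/2⌉⇒m+m<n {suc m} {suc zero}    (s<s ())
m<⌈n/2⌉⇒m+m<n {suc m} {suc (suc n)} m<⌈n/2⌉ rewrite +-suc m m =
  s<s (s<s (m<⌈n/2⌉⇒m+m<n (s<s⁻¹ m<⌈n/2⌉)))

1+m+m<n⇒m<⌊n/2⌋ : ∀ {m n} → suc (m + m) < n → m < ⌊ n /2⌋
1+m+m<n⇒m<⌊n/2⌋ {n = suc n} 1+m+m<n = m+m<n⇒m<⌈n/2⌉ (s<s⁻¹ 1+m+m<n)

m<⌊n/2⌋⇒1+m+m<n : ∀ {m n} → m < ⌊ n /2⌋ → suc (m + m) < n
m<⌊n/2⌋⇒1+m+m<n {n = suc n} m<⌊n/2⌋ = s<s (m<⌈n/2⌉⇒m+m<n m<⌊n/2⌋)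

n≤o⇒m≤n+o⇒∣m-n∣≤o : ∀ {m n o} → n ≤ o → m ≤ n + o → ∣ m - n ∣ ≤ o
n≤o⇒m≤n+o⇒∣m-n∣≤o {m}     {zero}  _   m≤o     = subst (_≤ _) (sym (∣-∣-identityʳ m)) m≤o
n≤o⇒m≤n+o⇒∣m-n∣≤o {zero}  {suc n} n≤o _       = n≤o
n≤o⇒m≤n+o⇒∣m-n∣≤o {suc m} {suc n} n≤o m≤n+o =
  n≤o⇒m≤n+o⇒∣m-n∣≤o (≤-trans (n≤1+n n) n≤o) (s≤s⁻¹ m≤n+o)

data Halving : ℕ → Set where
  even : ∀ j → Halving (j + j)
  odd  : ∀ j → Halving (suc (j + j))

halving : ∀ i → Halving i
halving zero = even 0
halving (suc i) with halving i
... | even j = odd j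
... | odd j  = subst Halving (cong suc (+-suc j j)) (even (suc j))

zigzag : ℕ → ℕ → ℕ
zigzag h zero          = h
zigzag h (suc zero)    = zero
zigzag h (suc (suc i)) = suc (zigzag h i)

zigzag-even : ∀ h j → zigzag h (j + j) ≡ h + j
zigzag-even h zero    = sym (+-identityʳ h)
zigzag-even h (suc j) rewrite +-suc j j = trans (cong suc (zigzag-even h j)) (sym (+-suc h j))

zigzag-odd : ∀ h j → zigzag h (suc (j + j)) ≡ j
zigzag-odd h zero    = refl
zigzag-odd h (suc j) rewrite +-suc j j = cong suc (zigzag-odd h j)

zigzag-gap : ∀ h i → h ≤ ∣ zigzag h (suc i) - zigzag h i ∣
zigzag-gap h zero          = ≤-refl
zigzag-gap h (suc zero)    = n≤1+n h
zigzag-gap h (suc (suc i)) = zigzag-gap h i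

unzigzag : ℕ → ℕ → ℕ
unzigzag h v with v <? h
... | yes _ = suc (v + v)
... | no  _ = (v ∸ h) + (v ∸ h)

unzigzag-below : ∀ {h v} → v < h → unzigzag h v ≡ suc (v + v)
unzigzag-below {h} {v} v<h with v <? h
... | yes _   = refl
... | no  v≮h = contradiction v<h v≮h

unzigzag-above : ∀ h d → unzigzag h (h + d) ≡ d + d
unzigzag-above h d with h + d <? h
... | yes h+d<h = contradiction h+d<h (m+n≮m h d)
... | no  _     = cong₂ _+_ (m+n∸m≡n h d) (m+n∸m≡n h d)

zigzag∘unzigzag : ∀ h v → zigzag h (unzigzag h v) ≡ v
zigzag∘unzigzag h v with v <? h
... | yes _   = zigzag-odd h v
... | no  v≮h = trans (zigzag-even h (v ∸ h)) (m+[n∸m]≡n (≮⇒≥ v≮h))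

unzigzag∘zigzag : ∀ {n i} → i < n → unzigzag ⌊ n /2⌋ (zigzag ⌊ n /2⌋ i) ≡ i
unzigzag∘zigzag {n} {i} i<n with halving i
... | even j rewrite zigzag-even ⌊ n /2⌋ j = unzigzag-above ⌊ n /2⌋ j
... | odd  j rewrite zigzag-odd ⌊ n /2⌋ j  = unzigzag-below (1+m+m<n⇒m<⌊n/2⌋ i<n)

zigzag<n : ∀ {n i} → i < n → zigzag ⌊ n /2⌋ i < n
zigzag<n {n} {i} i<n with halving i
... | even j rewrite zigzag-even ⌊ n /2⌋ j =
  subst (⌊ n /2⌋ + j <_) (⌊n/2⌋+⌈n/2⌉≡n n) (+-monoʳ-< ⌊ n /2⌋ (m+m<n⇒m<⌈n/2⌉ i<n))
... | odd  j rewrite zigzag-odd ⌊ n /2⌋ j =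
  <-≤-trans (1+m+m<n⇒m<⌊n/2⌋ i<n) (⌊n/2⌋≤n n)

unzigzag<n : ∀ {n v} → v < n → unzigzag ⌊ n /2⌋ v < n
unzigzag<n {n} {v} v<n with v <? ⌊ n /2⌋
... | yes v<h = m<⌊n/2⌋⇒1+m+m<n v<h
... | no  v≮h = m<⌈n/2⌉⇒m+m<n (+-cancelˡ-< ⌊ n /2⌋ (v ∸ ⌊ n /2⌋) ⌈ n /2⌉ h+d<h+⌈n/2⌉)
  where
  open ≤-Reasoning
  h+d<h+⌈n/2⌉ : ⌊ n /2⌋ + (v ∸ ⌊ n /2⌋) < ⌊ n /2⌋ + ⌈ n /2⌉
  h+d<h+⌈n/2⌉ = begin-strict
    ⌊ n /2⌋ + (v ∸ ⌊ n /2⌋) ≡⟨ m+[n∸m]≡n (≮⇒≥ v≮h) ⟩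
    v                       <⟨ v<n ⟩
    n                       ≡⟨ ⌊n/2⌋+⌈n/2⌉≡n n ⟨
    ⌊ n /2⌋ + ⌈ n /2⌉       ∎

module _ {n : ℕ} (f g : ℕ → ℕ)
         (f<n : ∀ {i} → i < n → f i < n) (g<n : ∀ {v} → v < n → g v < n)
         (f∘g : ∀ {v} → v < n → f (g v) ≡ v) (g∘f : ∀ {i} → i < n → g (f i) ≡ i)
         where

  private
    KeepsBelow : (ℕ → ℕ) → Set
    KeepsBelow k = ∀ {i} → i < n → k i < n

    onFin : (k : ℕ → ℕ) → KeepsBelow k → Fin n → Fin n
    onFin k k<n i = fromℕ< (k<n (toℕ<n i))

    toℕ-onFin : ∀ k (k<n : KeepsBelow k) i → toℕ (onFin k k<n i) ≡ k (toℕ i)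
    toℕ-onFin k k<n i = toℕ-fromℕ< (k<n (toℕ<n i))

    onFin-inverse : ∀ k l (k<n : KeepsBelow k) (l<n : KeepsBelow l) → (∀ {i} → i < n → k (l i) ≡ i) →
                    ∀ i → onFin k k<n (onFin l l<n i) ≡ i
    onFin-inverse k l k<n l<n k∘l i = toℕ-injective (begin
      toℕ (onFin k k<n (onFin l l<n i)) ≡⟨ toℕ-onFin k k<n _ ⟩
      k (toℕ (onFin l l<n i))           ≡⟨ cong k (toℕ-onFin l l<n i) ⟩
      k (l (toℕ i))                     ≡⟨ k∘l (toℕ<n i) ⟩
      toℕ i                             ∎)
      where open ≡-Reasoning

  permutationFromℕ : Permutation′ n
  permutationFromℕ = permutation (onFin f f<n) (onFin g g<n)
                       (onFin-inverse f g f<n g<n f∘g) (onFin-inverse g f g<n f<n g∘f)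

zigzagPermutation : ∀ n → Permutation′ n
zigzagPermutation n = permutationFromℕ (zigzag ⌊ n /2⌋) (unzigzag ⌊ n /2⌋) zigzag<n unzigzag<n
                        (λ {v} _ → zigzag∘unzigzag ⌊ n /2⌋ v) unzigzag∘zigzag

toℕ-zigzagPermutation : ∀ n i → toℕ (zigzagPermutation n ⟨$⟩ʳ i) ≡ zigzag ⌊ n /2⌋ (toℕ i)
toℕ-zigzagPermutation n i = toℕ-fromℕ< (zigzag<n (toℕ<n i))

minFin≤ : ∀ k f i → minFin k f ≤ f i
minFin≤ zero    f fzero    = ≤-refl
minFin≤ (suc k) f fzero    = m⊓n≤m _ _
minFin≤ (suc k) f (fsuc i) = ≤-trans (m⊓n≤n _ _) (minFin≤ k (λ i → f (fsuc i)) i)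

minFin-greatest : ∀ k f {x} → (∀ i → x ≤ f i) → x ≤ minFin k f
minFin-greatest zero    f x≤f = x≤f fzero
minFin-greatest (suc k) f x≤f = ⊓-glb (x≤f fzero) (minFin-greatest k (λ i → f (fsuc i)) (λ i → x≤f (fsuc i)))

gap-zigzag : ∀ m i → gap m (zigzagPermutation (suc (suc m))) i
                     ≡ ∣ zigzag ⌊ suc (suc m) /2⌋ (suc (toℕ i)) - zigzag ⌊ suc (suc m) /2⌋ (toℕ i) ∣
gap-zigzag m i = cong₂ ∣_-_∣ (toℕ-zigzagPermutation _ (fsuc i))
  (trans (toℕ-zigzagPermutation _ (inject₁ i)) (cong (zigzag ⌊ suc (suc m) /2⌋) (toℕ-inject₁ i)))

minGap-zigzag : ∀ m → minGap m (zigzagPermutation (suc (suc m))) ≡ ⌊ suc (suc m) /2⌋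
minGap-zigzag m = ≤-antisym
  (≤-trans (minFin≤ m _ fzero) (≤-reflexive (gap-zigzag m fzero)))
  (minFin-greatest m _ λ i → subst (_ ≤_) (sym (gap-zigzag m i)) (zigzag-gap _ (toℕ i)))

minGap≤adjacent : ∀ m π p → ∃ λ q → minGap m π ≤ ∣ toℕ (π ⟨$⟩ʳ q) - toℕ (π ⟨$⟩ʳ p) ∣
minGap≤adjacent m π fzero    = fsuc fzero , minFin≤ m (gap m π) fzero
minGap≤adjacent m π (fsuc i) = inject₁ i ,
  subst (minGap m π ≤_) (∣-∣-comm (toℕ (π ⟨$⟩ʳ fsuc i)) (toℕ (π ⟨$⟩ʳ inject₁ i))) (minFin≤ m (gap m π) i)

minGap≤neighbourOf : ∀ m π v → ∃ λ q → minGap m π ≤ ∣ toℕ (π ⟨$⟩ʳ q) - toℕ v ∣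
minGap≤neighbourOf m π v = subst (λ w → ∃ λ q → minGap m π ≤ ∣ toℕ (π ⟨$⟩ʳ q) - toℕ w ∣)
                             (inverseʳ π) (minGap≤adjacent m π (π ⟨$⟩ˡ v))

minGap≤⌊n/2⌋ : ∀ m π → minGap m π ≤ ⌊ suc (suc m) /2⌋
minGap≤⌊n/2⌋ m π = viaNeighbour (minGap≤neighbourOf m π centre)
  where
  -- ⌈ suc m /2⌉ unfolds to ⌊ suc (suc m) /2⌋
  h = ⌈ suc m /2⌉
  centre : Fin (suc (suc m))
  centre = fromℕ< (s≤s (⌊n/2⌋≤n (suc m)))
  ∣y-c∣≤h : ∀ y → ∣ toℕ y - toℕ centre ∣ ≤ h
  ∣y-c∣≤h y rewrite toℕ-fromℕ< (s≤s (⌊n/2⌋≤n (suc m))) =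
    n≤o⇒m≤n+o⇒∣m-n∣≤o (⌊n/2⌋≤⌈n/2⌉ (suc m)) (subst (toℕ y ≤_) (sym (⌊n/2⌋+⌈n/2⌉≡n (suc m))) (s≤s⁻¹ (toℕ<n y)))
  viaNeighbour : (∃ λ q → minGap m π ≤ ∣ toℕ (π ⟨$⟩ʳ q) - toℕ centre ∣) → minGap m π ≤ h
  viaNeighbour (q , minGap≤∣πq-c∣) = ≤-trans minGap≤∣πq-c∣ (∣y-c∣≤h (π ⟨$⟩ʳ q))

theorem4p1 : (m : ℕ) →
    (∃ λ (π : Permutation′ (suc (suc m))) → minGap m π ≡ suc (suc m) / 2)
    × ((π : Permutation′ (suc (suc m))) → minGap m π ≤ suc (suc m) / 2)
theorem4p1 m rewrite n/2≡⌊n/2⌋ (suc (suc m)) =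
  (zigzagPermutation (suc (suc m)) , minGap-zigzag m) , minGap≤⌊n/2⌋ m
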